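{- Let $h$ be a positive integer with $h+2\le n$, and let $L_W$ be an $h$-club of rank $h+2$ in $\mathrm{PG}(1,q^n)$. Then $L_W$ is $\mathrm{PGL}(2,q^n)$-equivalent to a linear set $L_U$, where $U=(S\times\{0\})\oplus\langle(1,1)\rangle_{\mathbb{F}_q}\oplus\langle(a,b)\rangle_{\mathbb{F}_q}$ for some $h$-dimensional $\mathbb{F}_q$-subspace $S$ of $\mathbb{F}_{q^n}$ containing $1$, and some $a,b\in\mathbb{F}_{q^n}$ with $a\notin S$, $b\notin\mathbb{F}_q$ and $a\notin S+bS$.
   Context: $q$ is a prime power and $n$ a positive integer. For an $\mathbb{F}_q$-subspace $U$ of $\mathbb{F}_{q^n}^2$, $L_U=\{\langle u\rangle_{\mathbb{F}_{q^n}}: u\in U\setminus\{0\}\}\subseteq\mathrm{PG}(1,q^n)$ is an $\mathbb{F}_q$-linear set of rank $\dim_{\mathbb{F}_q}U$; the weight of $P=\langle v\rangle_{\mathbb{F}_{q^n}}$ is $w_{L_U}(P)=\dim_{\mathbb{F}_q}(U\cap\langle v\rangle_{\mathbb{F}_{q^n}})$. An $h$-club of rank $k$ is an $\mathbb{F}_q$-linear set of rank $k$ in which exactly one point has weight $h$ and all other points have weight $1$. Two linear sets are $\mathrm{PGL}(2,q^n)$-equivalent if some projectivity of $\mathrm{PG}(1,q^n)$ maps one onto the other. $bS=\{bs:s\in S\}$. -}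

module Defs where

open import Level using (Level; 0ℓ) renaming (suc to lsuc)
open import Data.Nat using (ℕ; zero; suc; _^_; _<_)
open import Data.Nat.Primality using (Prime)
open import Data.Fin using (Fin; zero; suc)
open import Data.Bool using (Bool; true)
open import Data.Product using (Σ; ∃; ∃-syntax; _×_; _,_)
open import Relation.Binary.PropositionalEquality using (_≡_; _≢_)
open import Relation.Nullary using (¬_)
open import Algebra.Structures using (IsCommutativeRing)
open import Function.Bundles using (_↔_)

IsPrimePower : ℕ → Set
IsPrimePower q = ∃[ p ] ∃[ k ] (Prime p × 0 < k × q ≡ p ^ k)

-- A finite field K of order q^n (i.e. F_{q^n}) together with its subfield
-- F_q, given as a (Boolean-valued) subset of K that is a subfield with q elements.
record FFExt (q n : ℕ) : Set₁ where
  field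
    K    : Set
    _+_  : K → K → K
    _*_  : K → K → K
    -_   : K → K
    0#   : K
    1#   : K
    isCommutativeRing : IsCommutativeRing _≡_ _+_ _*_ -_ 0# 1#
    0≢1  : 0# ≢ 1#
    inverse : ∀ x → x ≢ 0# → ∃[ y ] (x * y ≡ 1#)
    card : K ↔ Fin (q ^ n)
    inFq   : K → Bool
    Fq-0   : inFq 0# ≡ true
    Fq-1   : inFq 1# ≡ true
    Fq-+   : ∀ x y → inFq x ≡ true → inFq y ≡ true → inFq (x + y) ≡ true
    Fq-*   : ∀ x y → inFq x ≡ true → inFq y ≡ true → inFq (x * y) ≡ true
    Fq-neg : ∀ x → inFq x ≡ true → inFq (- x) ≡ true
    Fq-inv : ∀ x y → inFq x ≡ true → x * y ≡ 1# → inFq y ≡ true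
    Fq-card : Σ K (λ x → inFq x ≡ true) ↔ Fin q

module _ {q n : ℕ} (F : FFExt q n) where
  open FFExt F

  Fq : K → Set
  Fq x = inFq x ≡ true

  -- Generic F_q-linear algebra on an F_q-space V (scalar action by K,
  -- restricted to scalars in F_q).
  module Lin (V : Set) (_⊕_ : V → V → V) (o : V) (_·_ : K → V → V) where

    lincomb : {k : ℕ} → (Fin k → K) → (Fin k → V) → V
    lincomb {zero}  c b = o
    lincomb {suc k} c b = (c zero · b zero) ⊕ lincomb (λ i → c (suc i)) (λ i → b (suc i))

    IsSubspace : (V → Set) → Set
    IsSubspace U = U o × (∀ u v → U u → U v → U (u ⊕ v))
                       × (∀ λ' u → Fq λ' → U u → U (λ' · u))

    HasDim : (V → Set) → ℕ → Set
    HasDim U k = Σ (Fin k → V) λ b →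
        (∀ i → U (b i))
      × (∀ c → (∀ i → Fq (c i)) → lincomb c b ≡ o → ∀ i → c i ≡ 0#)
      × (∀ v → U v → Σ (Fin k → K) λ c → (∀ i → Fq (c i)) × v ≡ lincomb c b)

  V2 : Set
  V2 = K × K

  _⊞_ : V2 → V2 → V2
  (x , y) ⊞ (x' , y') = (x + x') , (y + y')

  𝟘 : V2
  𝟘 = 0# , 0#

  _⊙_ : K → V2 → V2
  λ' ⊙ (x , y) = (λ' * x) , (λ' * y)

  open Lin V2 _⊞_ 𝟘 _⊙_ public using ()
    renaming (IsSubspace to IsSubspace2; HasDim to HasDim2)
  open Lin K _+_ 0# _*_ public using ()
    renaming (IsSubspace to IsSubspace1; HasDim to HasDim1)

  -- u spans (over F_{q^n}) the same point as v is captured by: u ∈ ⟨v⟩_{F_{q^n}}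
  InPoint : V2 → V2 → Set
  InPoint v u = ∃[ λ' ] (u ≡ λ' ⊙ v)

  Weight : (V2 → Set) → V2 → ℕ → Set
  Weight U v h = HasDim2 (λ u → U u × InPoint v u) h

  InLinSet : (V2 → Set) → V2 → Set
  InLinSet U v = ∃[ u ] (U u × u ≢ 𝟘 × InPoint v u)

  IsClub : ℕ → ℕ → (V2 → Set) → Set
  IsClub h k U = IsSubspace2 U × HasDim2 U k
    × ∃[ v ] (v ≢ 𝟘 × Weight U v h
        × (∀ w → w ≢ 𝟘 → InLinSet U w → ¬ InPoint v w → Weight U w 1))

  act : K → K → K → K → V2 → V2
  act α β γ δ (x , y) = ((α * x) + (β * y)) , ((γ * x) + (δ * y))

  PGLEquiv : (V2 → Set) → (V2 → Set) → Set
  PGLEquiv W U = ∃[ α ] ∃[ β ] ∃[ γ ] ∃[ δ ]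
      (((α * δ) + (- (β * γ))) ≢ 0#
    × (∀ w → W w → w ≢ 𝟘 → InLinSet U (act α β γ δ w))
    × (∀ u → U u → u ≢ 𝟘 → ∃[ w ] (W w × w ≢ 𝟘 × InPoint (act α β γ δ w) u)))

  ClubU : (K → Set) → K → K → V2 → Set
  ClubU S a b v = ∃[ s ] ∃[ x ] ∃[ y ]
    (S s × Fq x × Fq y × v ≡ (((s + x) + (y * a)) , (x + (y * b))))

  InSumBS : (K → Set) → K → K → Set
  InSumBS S b a = ∃[ s ] ∃[ t ] (S s × S t × a ≡ s + (b * t))

-- Let E be an F_q-basis of W ∩ ⟨v⟩ for the point ⟨v⟩ of weight h, and e₁ = E 0.
-- Since dim W = h + 2 > h, some basis vector w₂ of W lies off ⟨v⟩, and there is a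
-- projectivity T with T e₁ = (1,0) and T w₂ = (1,1). It maps W ∩ ⟨v⟩ onto S × {0}
-- with S = {σ : σ e₁ ∈ W}, an h-dimensional space containing 1. Since h + 2 > h + 1,
-- some basis vector w₃ has second T-coordinate b ∉ F_q; let a be its first one.
-- Since h + 2 < h + 3, the second T-coordinate of every w ∈ W lies in ⟨1, b⟩_{F_q},
-- which gives T(W) = (S × {0}) ⊕ ⟨(1,1)⟩ ⊕ ⟨(a,b)⟩. All three counts are instances of
-- the Steinitz exchange lemma. Finally, if a = s + b t with s, t ∈ S, then W contains
-- z₁ = T⁻¹(t,1) and b z₁ = T⁻¹(bt,b); as z₁ spans a point of weight one, b ∈ F_q.
-- The case t = 0 gives a ∉ S.

module Submission where

open import Defs
open import Data.Nat as ℕ using (ℕ; zero; suc; _≤_; _<_; z≤n; s≤s)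
import Data.Nat.Properties as ℕ
open import Data.Fin using (Fin; zero; suc; punchIn)
open import Data.Fin.Properties using (any?; inj⇒≟)
open import Data.Vec.Functional using (_∷_; tail; insertAt)
open import Data.Vec.Functional.Properties using (insertAt-punchIn; insertAt-lookup)
open import Data.Product using (Σ; ∃; ∃-syntax; _×_; _,_; proj₁; proj₂)
open import Data.Empty using (⊥-elim)
open import Data.Bool using (true)
import Data.Bool as Bool
open import Level using (Level; 0ℓ)
open import Function using (_∘_; Inverse)
open import Function.Properties.Inverse using (↔⇒↣)
open import Relation.Binary.PropositionalEquality
  using (_≡_; _≢_; refl; sym; trans; cong; cong₂; subst; module ≡-Reasoning)
open import Relation.Binary.Definitions using (DecidableEquality)
open import Relation.Nullary using (¬_; Dec; yes; no; ¬?; _×-dec_)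
open import Relation.Nullary.Decidable using (map′; decidable-stable)
open import Relation.Unary using (Decidable)
open import Algebra.Bundles using (CommutativeRing)

-- Integer coefficients let the solver decide equality of coefficients, so that
-- cancellations such as x - x = 0 normalise.
module IntegerCoefficientSolver {c ℓ : Level} (R : CommutativeRing c ℓ) where
  open import Data.Integer as ℤ using (ℤ; +_; -[1+_]; _⊖_)
  import Data.Integer.Properties as ℤ
  open import Data.Sign as Sign using (Sign)
  open import Data.Maybe using (Maybe; just; nothing)
  open import Algebra.Solver.Ring.AlmostCommutativeRing
    using (fromCommutativeRing; _-Raw-AlmostCommutative⟶_)

  open CommutativeRing R renaming (refl to ≈-refl; sym to ≈-sym; trans to ≈-trans)
  open import Algebra.Properties.Ring ring
    using (-‿distribˡ-*; -‿distribʳ-*; -‿+-comm; -0#≈0#; -‿involutive)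
  open import Algebra.Properties.Semiring.Mult.TCOptimised semiring
    using (×-homo-+; ×1-homo-*; 1+×) renaming (_×_ to _×ᵣ_)
  open import Algebra.Properties.CommutativeSemigroup +-commutativeSemigroup using (interchange)
  open import Relation.Binary.Reasoning.Setoid setoid

  signed : Sign → Carrier → Carrier
  signed Sign.+ x = x
  signed Sign.- x = - x

  ⟦_⟧ℤ : ℤ → Carrier
  ⟦ + m ⟧ℤ = m ×ᵣ 1#
  ⟦ -[1+ m ] ⟧ℤ = - (suc m ×ᵣ 1#)

  ⟦⊖⟧ : ∀ m n → ⟦ m ⊖ n ⟧ℤ ≈ m ×ᵣ 1# - n ×ᵣ 1#
  ⟦⊖⟧ m zero = begin
    m ×ᵣ 1#        ≈⟨ +-identityʳ _ ⟨
    m ×ᵣ 1# + 0#   ≈⟨ +-congˡ -0#≈0# ⟨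
    m ×ᵣ 1# - 0#   ∎
  ⟦⊖⟧ zero (suc n) = ≈-sym (+-identityˡ _)
  ⟦⊖⟧ (suc m) (suc n) = begin
    ⟦ suc m ⊖ suc n ⟧ℤ                         ≡⟨ cong ⟦_⟧ℤ (ℤ.[1+m]⊖[1+n]≡m⊖n m n) ⟩
    ⟦ m ⊖ n ⟧ℤ                                 ≈⟨ ⟦⊖⟧ m n ⟩
    m ×ᵣ 1# - n ×ᵣ 1#                            ≈⟨ +-identityˡ _ ⟨
    0# + (m ×ᵣ 1# - n ×ᵣ 1#)                     ≈⟨ +-congʳ (-‿inverseʳ 1#) ⟨
    (1# - 1#) + (m ×ᵣ 1# - n ×ᵣ 1#)              ≈⟨ interchange 1# (- 1#) (m ×ᵣ 1#) (- (n ×ᵣ 1#)) ⟩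
    (1# + m ×ᵣ 1#) + (- 1# - n ×ᵣ 1#)            ≈⟨ +-congˡ (-‿+-comm 1# (n ×ᵣ 1#)) ⟩
    (1# + m ×ᵣ 1#) - (1# + n ×ᵣ 1#)              ≈⟨ +-cong (1+× m 1#) (-‿cong (1+× n 1#)) ⟨
    suc m ×ᵣ 1# - suc n ×ᵣ 1#                    ∎

  ⟦+⟧ : ∀ i j → ⟦ i ℤ.+ j ⟧ℤ ≈ ⟦ i ⟧ℤ + ⟦ j ⟧ℤ
  ⟦+⟧ (+ m) (+ n) = ×-homo-+ 1# m n
  ⟦+⟧ (+ m) -[1+ n ] = ⟦⊖⟧ m (suc n)
  ⟦+⟧ -[1+ m ] (+ n) = ≈-trans (⟦⊖⟧ n (suc m)) (+-comm _ _)
  ⟦+⟧ -[1+ m ] -[1+ n ] = begin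
    - (suc (suc (m ℕ.+ n)) ×ᵣ 1#)           ≡⟨ cong (λ k → - (suc k ×ᵣ 1#)) (ℕ.+-suc m n) ⟨
    - ((suc m ℕ.+ suc n) ×ᵣ 1#)             ≈⟨ -‿cong (×-homo-+ 1# (suc m) (suc n)) ⟩
    - (suc m ×ᵣ 1# + suc n ×ᵣ 1#)            ≈⟨ -‿+-comm _ _ ⟨
    - (suc m ×ᵣ 1#) - suc n ×ᵣ 1#            ∎

  ⟦◃⟧ : ∀ s m → ⟦ s ℤ.◃ m ⟧ℤ ≈ signed s (m ×ᵣ 1#)
  ⟦◃⟧ Sign.+ zero = ≈-refl
  ⟦◃⟧ Sign.- zero = ≈-sym -0#≈0#
  ⟦◃⟧ Sign.+ (suc m) = ≈-refl
  ⟦◃⟧ Sign.- (suc m) = ≈-refl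

  ⟦⟧≈signed : ∀ i → ⟦ i ⟧ℤ ≈ signed (ℤ.sign i) (ℤ.∣ i ∣ ×ᵣ 1#)
  ⟦⟧≈signed (+ zero) = ≈-refl
  ⟦⟧≈signed (+ suc m) = ≈-refl
  ⟦⟧≈signed -[1+ m ] = ≈-refl

  signed-* : ∀ s t x y → signed (s Sign.* t) (x * y) ≈ signed s x * signed t y
  signed-* Sign.+ Sign.+ x y = ≈-refl
  signed-* Sign.+ Sign.- x y = -‿distribʳ-* x y
  signed-* Sign.- Sign.+ x y = -‿distribˡ-* x y
  signed-* Sign.- Sign.- x y = begin
    x * y          ≈⟨ -‿involutive _ ⟨
    - - (x * y)    ≈⟨ -‿cong (-‿distribʳ-* x y) ⟩
    - (x * - y)    ≈⟨ -‿distribˡ-* x (- y) ⟩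
    - x * - y      ∎

  ⟦*⟧ : ∀ i j → ⟦ i ℤ.* j ⟧ℤ ≈ ⟦ i ⟧ℤ * ⟦ j ⟧ℤ
  ⟦*⟧ i j = begin
    ⟦ i ℤ.* j ⟧ℤ                                   ≈⟨ ⟦◃⟧ (s Sign.* t) (ℤ.∣ i ∣ ℕ.* ℤ.∣ j ∣) ⟩
    signed (s Sign.* t) ((ℤ.∣ i ∣ ℕ.* ℤ.∣ j ∣) ×ᵣ 1#) ≈⟨ signed-cong (s Sign.* t) (×1-homo-* ℤ.∣ i ∣ ℤ.∣ j ∣) ⟩
    signed (s Sign.* t) (ℤ.∣ i ∣ ×ᵣ 1# * ℤ.∣ j ∣ ×ᵣ 1#) ≈⟨ signed-* s t _ _ ⟩
    signed s (ℤ.∣ i ∣ ×ᵣ 1#) * signed t (ℤ.∣ j ∣ ×ᵣ 1#) ≈⟨ *-cong (⟦⟧≈signed i) (⟦⟧≈signed j) ⟨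
    ⟦ i ⟧ℤ * ⟦ j ⟧ℤ                                ∎
    where
    s = ℤ.sign i
    t = ℤ.sign j
    signed-cong : ∀ s {x y} → x ≈ y → signed s x ≈ signed s y
    signed-cong Sign.+ p = p
    signed-cong Sign.- p = -‿cong p

  ⟦-⟧ : ∀ i → ⟦ ℤ.- i ⟧ℤ ≈ - ⟦ i ⟧ℤ
  ⟦-⟧ (+ zero) = ≈-sym -0#≈0#
  ⟦-⟧ (+ suc m) = ≈-refl
  ⟦-⟧ -[1+ m ] = ≈-sym (-‿involutive _)

  ⟦⟧-homomorphism : ℤ.+-*-rawRing -Raw-AlmostCommutative⟶ fromCommutativeRing R
  ⟦⟧-homomorphism = record
    { ⟦_⟧ = ⟦_⟧ℤ ; +-homo = ⟦+⟧ ; *-homo = ⟦*⟧ ; -‿homo = ⟦-⟧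
    ; 0-homo = ≈-refl ; 1-homo = ≈-refl }

  ⟦⟧-≟ : ∀ i j → Maybe (⟦ i ⟧ℤ ≈ ⟦ j ⟧ℤ)
  ⟦⟧-≟ i j with i ℤ.≟ j
  ... | yes refl = just ≈-refl
  ... | no _ = nothing

  open import Algebra.Solver.Ring ℤ.+-*-rawRing (fromCommutativeRing R) ⟦⟧-homomorphism ⟦⟧-≟ public

  :0 :1 : ∀ {n} → Polynomial n
  :0 = con (+ 0)
  :1 = con (+ 1)

insertAt-preserves : ∀ {A : Set} {m} (P : A → Set) (d : Fin m → A) (j : Fin (suc m)) {α : A} →
                     (∀ i → P (d i)) → P α → ∀ x → P (insertAt d j α x)
insertAt-preserves P d zero d-P α-P zero    = α-P
insertAt-preserves P d zero d-P α-P (suc x) = d-P x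
insertAt-preserves {m = suc m} P d (suc j) d-P α-P zero    = d-P zero
insertAt-preserves {m = suc m} P d (suc j) d-P α-P (suc x) = insertAt-preserves P (tail d) j (d-P ∘ suc) α-P x

module _ {q n : ℕ} (F : FFExt q n) where
  open FFExt F hiding (_+_; _*_; -_)
  open ≡-Reasoning

  K-ring : CommutativeRing 0ℓ 0ℓ
  K-ring = record { isCommutativeRing = isCommutativeRing }

  open CommutativeRing K-ring
    using ( _+_; _*_; -_; _-_; +-assoc; +-comm; +-identityˡ; +-identityʳ; -‿inverseʳ
          ; *-assoc; *-identityˡ; *-identityʳ; zeroˡ; zeroʳ; distribˡ; distribʳ)
  open import Algebra.Properties.Ring (CommutativeRing.ring K-ring) using (-1*x≈-x)
  open IntegerCoefficientSolver K-ring using (solve; _:+_; _:*_; :-_; _:-_; _:=_; :0; :1)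

  infix 4 _≟_
  _≟_ : DecidableEquality K
  _≟_ = inj⇒≟ (↔⇒↣ card)

  ∃? : {P : K → Set} → Decidable P → Dec (∃ P)
  ∃? {P} P? = map′ (λ (i , p) → from i , p)
                   (λ (x , p) → to x , subst P (sym (strictlyInverseʳ x)) p)
                   (any? (P? ∘ from))
    where open Inverse card

  Fq? : Decidable (Fq F)
  Fq? x = inFq x Bool.≟ true

  inv : (x : K) → x ≢ 0# → K
  inv x x≢0 = proj₁ (inverse x x≢0)

  *-inv : ∀ x (x≢0 : x ≢ 0#) → x * inv x x≢0 ≡ 1#
  *-inv x x≢0 = proj₂ (inverse x x≢0)

  inv-Fq : ∀ {x} (x≢0 : x ≢ 0#) → Fq F x → Fq F (inv x x≢0)
  inv-Fq x≢0 x-Fq = Fq-inv _ _ x-Fq (*-inv _ x≢0)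

  *-inv-cancelʳ : ∀ x {y} (y≢0 : y ≢ 0#) → x * y * inv y y≢0 ≡ x
  *-inv-cancelʳ x {y} y≢0 = begin
    x * y * inv y y≢0   ≡⟨ *-assoc x y _ ⟩
    x * (y * inv y y≢0) ≡⟨ cong (x *_) (*-inv y y≢0) ⟩
    x * 1#              ≡⟨ *-identityʳ x ⟩
    x                   ∎

  *-cancelʳ : ∀ {x y z} → y ≢ 0# → x * y ≡ z * y → x ≡ z
  *-cancelʳ {x} {y} {z} y≢0 xy≡zy = begin
    x                 ≡⟨ sym (*-inv-cancelʳ x y≢0) ⟩
    x * y * inv y y≢0 ≡⟨ cong (_* inv y y≢0) xy≡zy ⟩
    z * y * inv y y≢0 ≡⟨ *-inv-cancelʳ z y≢0 ⟩
    z                 ∎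

  Fq-cancelʳ : ∀ {x y} → y ≢ 0# → Fq F y → Fq F (x * y) → Fq F x
  Fq-cancelʳ {x} y≢0 y-Fq xy-Fq = subst (Fq F) (*-inv-cancelʳ x y≢0) (Fq-* _ _ xy-Fq (inv-Fq y≢0 y-Fq))

  InFq⟨1,_⟩ : K → K → Set
  InFq⟨1, b ⟩ y = ∃[ x ] ∃[ t ] (Fq F x × Fq F t × y ≡ x + t * b)

  InFq⟨1,?⟩ : ∀ b → Decidable InFq⟨1, b ⟩
  InFq⟨1,?⟩ b y = ∃? λ x → ∃? λ t → Fq? x ×-dec Fq? t ×-dec (y ≟ x + t * b)

  Fq-independent₂ : ∀ {b c₀ c₁} → ¬ Fq F b → Fq F c₀ → Fq F c₁ →
                    c₀ + c₁ * b ≡ 0# → c₀ ≡ 0# × c₁ ≡ 0#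
  Fq-independent₂ {b} {c₀} {c₁} b∉Fq c₀-Fq c₁-Fq sum≡0 with c₁ ≟ 0#
  ... | no c₁≢0 = ⊥-elim (b∉Fq (Fq-cancelʳ c₁≢0 c₁-Fq (subst (Fq F) -c₀≡bc₁ (Fq-neg _ c₀-Fq))))
    where
    -c₀≡bc₁ : - c₀ ≡ b * c₁
    -c₀≡bc₁ = begin
      - c₀                    ≡⟨ solve 3 (λ b c₀ c₁ → :- c₀ := b :* c₁ :- (c₀ :+ c₁ :* b)) refl b c₀ c₁ ⟩
      b * c₁ - (c₀ + c₁ * b)  ≡⟨ cong (λ x → b * c₁ - x) sum≡0 ⟩
      b * c₁ - 0#             ≡⟨ solve 1 (λ x → x :- :0 := x) refl (b * c₁) ⟩
      b * c₁                  ∎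
  ... | yes c₁≡0 = (begin
      c₀              ≡⟨ solve 2 (λ b c₀ → c₀ := c₀ :+ :0 :* b) refl b c₀ ⟩
      c₀ + 0# * b     ≡⟨ cong (λ x → c₀ + x * b) (sym c₁≡0) ⟩
      c₀ + c₁ * b     ≡⟨ sum≡0 ⟩
      0#              ∎) , c₁≡0

  Fq-independent₃ : ∀ {b y c₀ c₁ c₂} → ¬ Fq F b → ¬ InFq⟨1, b ⟩ y → Fq F c₀ → Fq F c₁ → Fq F c₂ →
                    c₀ + c₁ * b + c₂ * y ≡ 0# → c₀ ≡ 0# × c₁ ≡ 0# × c₂ ≡ 0#
  Fq-independent₃ {b} {y} {c₀} {c₁} {c₂} b∉Fq y∉ c₀-Fq c₁-Fq c₂-Fq sum≡0 with c₂ ≟ 0#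
  ... | no c₂≢0 = ⊥-elim (y∉ (- (c₀ * ι) , - (c₁ * ι) , Fq-neg _ (Fq-* _ _ c₀-Fq ι-Fq) , Fq-neg _ (Fq-* _ _ c₁-Fq ι-Fq) , y≡))
    where
    ι = inv c₂ c₂≢0
    ι-Fq = inv-Fq c₂≢0 c₂-Fq
    y≡ : y ≡ - (c₀ * ι) + - (c₁ * ι) * b
    y≡ = begin
      y                                           ≡⟨ sym (*-inv-cancelʳ y c₂≢0) ⟩
      y * c₂ * ι                                  ≡⟨ solve 6 (λ y c₀ c₁ c₂ b ι → y :* c₂ :* ι := (c₀ :+ c₁ :* b :+ c₂ :* y) :* ι :+ (:- (c₀ :* ι) :+ :- (c₁ :* ι) :* b)) refl y c₀ c₁ c₂ b ι ⟩
      (c₀ + c₁ * b + c₂ * y) * ι + (- (c₀ * ι) + - (c₁ * ι) * b) ≡⟨ cong (λ x → x * ι + (- (c₀ * ι) + - (c₁ * ι) * b)) sum≡0 ⟩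
      0# * ι + (- (c₀ * ι) + - (c₁ * ι) * b)      ≡⟨ solve 2 (λ ι r → :0 :* ι :+ r := r) refl ι (- (c₀ * ι) + - (c₁ * ι) * b) ⟩
      - (c₀ * ι) + - (c₁ * ι) * b                 ∎
  ... | yes c₂≡0 = proj₁ c₀,c₁≡0 , proj₂ c₀,c₁≡0 , c₂≡0
    where
    c₀,c₁≡0 = Fq-independent₂ b∉Fq c₀-Fq c₁-Fq (begin
      c₀ + c₁ * b               ≡⟨ solve 3 (λ y c₀ c₁b → c₀ :+ c₁b := c₀ :+ c₁b :+ :0 :* y) refl y c₀ (c₁ * b) ⟩
      c₀ + c₁ * b + 0# * y      ≡⟨ cong (λ x → c₀ + c₁ * b + x * y) (sym c₂≡0) ⟩
      c₀ + c₁ * b + c₂ * y      ≡⟨ sum≡0 ⟩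
      0#                        ∎)

  -- F_q-linear algebra

  record IsFqSpace (V : Set) (_⊕_ : V → V → V) (o : V) (_·_ : K → V → V) : Set where
    field
      ⊕-assoc    : ∀ x y z → (x ⊕ y) ⊕ z ≡ x ⊕ (y ⊕ z)
      ⊕-comm     : ∀ x y → x ⊕ y ≡ y ⊕ x
      ⊕-identityˡ : ∀ x → o ⊕ x ≡ x
      ·-distribʳ : ∀ a b x → (a + b) · x ≡ (a · x) ⊕ (b · x)
      ·-distribˡ : ∀ a x y → a · (x ⊕ y) ≡ (a · x) ⊕ (a · y)
      ·-assoc    : ∀ a b x → (a * b) · x ≡ a · (b · x)
      ·-zeroˡ    : ∀ x → 0# · x ≡ o
      ·-zeroʳ    : ∀ a → a · o ≡ o
      ·-identityˡ : ∀ x → 1# · x ≡ x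

  open Lin F K _+_ 0# _*_ using () renaming (lincomb to lincombK)

  Fq-lincomb : ∀ {k} (c t : Fin k → K) → (∀ i → Fq F (c i)) → (∀ i → Fq F (t i)) → Fq F (lincombK c t)
  Fq-lincomb {zero}  c t c-Fq t-Fq = Fq-0
  Fq-lincomb {suc k} c t c-Fq t-Fq =
    Fq-+ _ _ (Fq-* _ _ (c-Fq zero) (t-Fq zero)) (Fq-lincomb (tail c) (tail t) (c-Fq ∘ suc) (t-Fq ∘ suc))

  module FqSpace {V : Set} {_⊕_ : V → V → V} {o : V} {_·_ : K → V → V}
                 (isFqSpace : IsFqSpace V _⊕_ o _·_) where
    open IsFqSpace isFqSpace
    open Lin F V _⊕_ o _·_ public using (lincomb; IsSubspace)

    Independent : ∀ {m} → (Fin m → V) → Set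
    Independent u = ∀ c → (∀ i → Fq F (c i)) → lincomb c u ≡ o → ∀ i → c i ≡ 0#

    InSpan : ∀ {k} → (Fin k → V) → V → Set
    InSpan {k} v x = Σ (Fin k → K) λ c → (∀ s → Fq F (c s)) × x ≡ lincomb c v

    ⊕-leftComm : ∀ a b c → a ⊕ (b ⊕ c) ≡ b ⊕ (a ⊕ c)
    ⊕-leftComm a b c = begin
      a ⊕ (b ⊕ c) ≡⟨ sym (⊕-assoc a b c) ⟩
      (a ⊕ b) ⊕ c ≡⟨ cong (_⊕ c) (⊕-comm a b) ⟩
      (b ⊕ a) ⊕ c ≡⟨ ⊕-assoc b a c ⟩
      b ⊕ (a ⊕ c) ∎

    ⊕-interchange : ∀ a b c d → (a ⊕ b) ⊕ (c ⊕ d) ≡ (a ⊕ c) ⊕ (b ⊕ d)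
    ⊕-interchange a b c d = begin
      (a ⊕ b) ⊕ (c ⊕ d) ≡⟨ ⊕-assoc a b (c ⊕ d) ⟩
      a ⊕ (b ⊕ (c ⊕ d)) ≡⟨ cong (a ⊕_) (⊕-leftComm b c d) ⟩
      a ⊕ (c ⊕ (b ⊕ d)) ≡⟨ sym (⊕-assoc a c (b ⊕ d)) ⟩
      (a ⊕ c) ⊕ (b ⊕ d) ∎

    lincomb-cong : ∀ {k} {c c′ : Fin k → K} {u u′ : Fin k → V} →
                   (∀ i → c i ≡ c′ i) → (∀ i → u i ≡ u′ i) → lincomb c u ≡ lincomb c′ u′
    lincomb-cong {zero}  p r = refl
    lincomb-cong {suc k} p r = cong₂ _⊕_ (cong₂ _·_ (p zero) (r zero)) (lincomb-cong (p ∘ suc) (r ∘ suc))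

    lincomb-zero : ∀ {k} (c : Fin k → K) (u : Fin k → V) → (∀ i → c i ≡ 0#) → lincomb c u ≡ o
    lincomb-zero {zero}  c u p = refl
    lincomb-zero {suc k} c u p = begin
      (c zero · u zero) ⊕ lincomb (tail c) (tail u) ≡⟨ cong₂ _⊕_ (cong (_· u zero) (p zero)) (lincomb-zero (tail c) (tail u) (p ∘ suc)) ⟩
      (0# · u zero) ⊕ o                            ≡⟨ cong (_⊕ o) (·-zeroˡ (u zero)) ⟩
      o ⊕ o                                         ≡⟨ ⊕-identityˡ o ⟩
      o ∎

    lincomb-+ : ∀ {k} (c d : Fin k → K) (u : Fin k → V) →
                lincomb (λ i → c i + d i) u ≡ lincomb c u ⊕ lincomb d u
    lincomb-+ {zero}  c d u = sym (⊕-identityˡ o)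
    lincomb-+ {suc k} c d u = trans
      (cong₂ _⊕_ (·-distribʳ (c zero) (d zero) (u zero)) (lincomb-+ (tail c) (tail d) (tail u)))
      (⊕-interchange _ _ _ _)

    lincomb-* : ∀ {k} (t : K) (c : Fin k → K) (u : Fin k → V) →
                lincomb (λ i → t * c i) u ≡ t · lincomb c u
    lincomb-* {zero}  t c u = sym (·-zeroʳ t)
    lincomb-* {suc k} t c u = trans
      (cong₂ _⊕_ (·-assoc t (c zero) (u zero)) (lincomb-* t (tail c) (tail u)))
      (sym (·-distribˡ t _ _))

    lincomb-punchIn : ∀ {m} (c : Fin (suc m) → K) (u : Fin (suc m) → V) (j : Fin (suc m)) →
      lincomb c u ≡ (c j · u j) ⊕ lincomb (c ∘ punchIn j) (u ∘ punchIn j)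
    lincomb-punchIn c u zero = refl
    lincomb-punchIn {suc m} c u (suc j) = trans
      (cong ((c zero · u zero) ⊕_) (lincomb-punchIn (tail c) (tail u) j))
      (⊕-leftComm _ _ _)

    lincomb-⊕· : ∀ {k} (c : Fin k → K) (x : Fin k → V) (t : Fin k → K) (y : V) →
      lincomb c (λ i → x i ⊕ (t i · y)) ≡ lincomb c x ⊕ (lincombK c t · y)
    lincomb-⊕· {zero} c x t y = begin
      o              ≡⟨ sym (⊕-identityˡ o) ⟩
      o ⊕ o          ≡⟨ cong (o ⊕_) (sym (·-zeroˡ y)) ⟩
      o ⊕ (0# · y)   ∎
    lincomb-⊕· {suc k} c x t y = begin
      (c zero · (x zero ⊕ (t zero · y))) ⊕ lincomb (tail c) (λ i → x (suc i) ⊕ (t (suc i) · y))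
        ≡⟨ cong₂ _⊕_ (trans (·-distribˡ _ _ _) (cong ((c zero · x zero) ⊕_) (sym (·-assoc _ _ _))))
                     (lincomb-⊕· (tail c) (tail x) (tail t) y) ⟩
      ((c zero · x zero) ⊕ ((c zero * t zero) · y)) ⊕ (lincomb (tail c) (tail x) ⊕ (lincombK (tail c) (tail t) · y))
        ≡⟨ ⊕-interchange _ _ _ _ ⟩
      ((c zero · x zero) ⊕ lincomb (tail c) (tail x)) ⊕ (((c zero * t zero) · y) ⊕ (lincombK (tail c) (tail t) · y))
        ≡⟨ cong (lincomb c x ⊕_) (sym (·-distribʳ _ _ _)) ⟩
      lincomb c x ⊕ (lincombK c t · y) ∎

    lincomb-scaled : ∀ {k} (c σ : Fin k → K) (e : V) →
                     lincomb c (λ i → σ i · e) ≡ lincombK c σ · e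
    lincomb-scaled {zero}  c σ e = sym (·-zeroˡ e)
    lincomb-scaled {suc k} c σ e = begin
      (c zero · (σ zero · e)) ⊕ lincomb (tail c) (λ i → σ (suc i) · e)
        ≡⟨ cong₂ _⊕_ (sym (·-assoc _ _ _)) (lincomb-scaled (tail c) (tail σ) e) ⟩
      ((c zero * σ zero) · e) ⊕ (lincombK (tail c) (tail σ) · e)
        ≡⟨ sym (·-distribʳ _ _ _) ⟩
      lincombK c σ · e ∎

    ·-neg-cancelˡ : ∀ y w x → (y · w) ⊕ (((- y) · w) ⊕ x) ≡ x
    ·-neg-cancelˡ y w x = begin
      (y · w) ⊕ (((- y) · w) ⊕ x) ≡⟨ sym (⊕-assoc _ _ x) ⟩
      ((y · w) ⊕ ((- y) · w)) ⊕ x ≡⟨ cong (_⊕ x) (sym (·-distribʳ y (- y) w)) ⟩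
      ((y - y) · w) ⊕ x           ≡⟨ cong (λ c → (c · w) ⊕ x) (-‿inverseʳ y) ⟩
      (0# · w) ⊕ x                ≡⟨ cong (_⊕ x) (·-zeroˡ w) ⟩
      o ⊕ x                       ≡⟨ ⊕-identityˡ x ⟩
      x                           ∎

    InSpan-∷ : ∀ {k x y} w (G : Fin k → V) → Fq F y → InSpan G x → InSpan (w ∷ G) ((y · w) ⊕ x)
    InSpan-∷ {y = y} w G y-Fq (c , c-Fq , x≡) =
      (y ∷ c) , (λ { zero → y-Fq ; (suc i) → c-Fq i }) , cong ((y · w) ⊕_) x≡

    ·-zero-⊕ : ∀ {c} x r → c ≡ 0# → (c · x) ⊕ r ≡ r
    ·-zero-⊕ x r c≡0 = trans (cong (λ c → (c · x) ⊕ r) c≡0) (trans (cong (_⊕ r) (·-zeroˡ x)) (⊕-identityˡ r))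

    independent⇒head≢o : ∀ {m} (u : Fin (suc m) → V) → Independent u → u zero ≢ o
    independent⇒head≢o {m} u u-indep u₀≡o = 0≢1 (sym (u-indep c c-Fq lincomb≡o zero))
      where
      c : Fin (suc m) → K
      c zero    = 1#
      c (suc _) = 0#
      c-Fq : ∀ i → Fq F (c i)
      c-Fq zero    = Fq-1
      c-Fq (suc _) = Fq-0
      lincomb≡o : lincomb c u ≡ o
      lincomb≡o = begin
        (1# · u zero) ⊕ lincomb (tail c) (tail u) ≡⟨ cong₂ _⊕_ (trans (·-identityˡ _) u₀≡o) (lincomb-zero (tail c) (tail u) (λ _ → refl)) ⟩
        o ⊕ o                                      ≡⟨ ⊕-identityˡ o ⟩
        o                                          ∎

    InSpan-tail : ∀ {k} (v : Fin (suc k) → V) {x} (x-span : InSpan v x) →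
                  proj₁ x-span zero ≡ 0# → InSpan (tail v) x
    InSpan-tail v {x} (c , c-Fq , x≡) c₀≡0 = tail c , c-Fq ∘ suc , (begin
      x                        ≡⟨ x≡ ⟩
      (c zero · v zero) ⊕ rest ≡⟨ cong (λ a → (a · v zero) ⊕ rest) c₀≡0 ⟩
      (0# · v zero) ⊕ rest     ≡⟨ cong (_⊕ rest) (·-zeroˡ (v zero)) ⟩
      o ⊕ rest                 ≡⟨ ⊕-identityˡ rest ⟩
      rest                     ∎)
      where rest = lincomb (tail c) (tail v)

    module PivotElimination {k m} (v : Fin (suc k) → V) (u : Fin (suc m) → V)
        (u-span : ∀ i → InSpan v (u i)) (j : Fin (suc m)) (pivot≢0 : proj₁ (u-span j) zero ≢ 0#) where

      C : Fin (suc m) → Fin (suc k) → K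
      C i = proj₁ (u-span i)

      C-Fq : ∀ i s → Fq F (C i s)
      C-Fq i = proj₁ (proj₂ (u-span i))

      u≡ : ∀ i → u i ≡ lincomb (C i) v
      u≡ i = proj₂ (proj₂ (u-span i))

      pivot⁻¹ : K
      pivot⁻¹ = inv (C j zero) pivot≢0

      t : Fin m → K
      t i = - (C (punchIn j i) zero * pivot⁻¹)

      t-Fq : ∀ i → Fq F (t i)
      t-Fq i = Fq-neg _ (Fq-* _ _ (C-Fq _ zero) (inv-Fq pivot≢0 (C-Fq j zero)))

      reduced : Fin m → V
      reduced i = u (punchIn j i) ⊕ (t i · u j)

      reduced-inSpan : ∀ i → InSpan (tail v) (reduced i)
      reduced-inSpan i = InSpan-tail v (D , D-Fq , reduced≡) D₀≡0
        where
        D : Fin (suc k) → K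
        D s = C (punchIn j i) s + t i * C j s
        D-Fq : ∀ s → Fq F (D s)
        D-Fq s = Fq-+ _ _ (C-Fq _ s) (Fq-* _ _ (t-Fq i) (C-Fq j s))
        reduced≡ : reduced i ≡ lincomb D v
        reduced≡ = begin
          u (punchIn j i) ⊕ (t i · u j)
            ≡⟨ cong₂ (λ x y → x ⊕ (t i · y)) (u≡ (punchIn j i)) (u≡ j) ⟩
          lincomb (C (punchIn j i)) v ⊕ (t i · lincomb (C j) v)
            ≡⟨ cong (lincomb (C (punchIn j i)) v ⊕_) (sym (lincomb-* (t i) (C j) v)) ⟩
          lincomb (C (punchIn j i)) v ⊕ lincomb (λ s → t i * C j s) v
            ≡⟨ sym (lincomb-+ (C (punchIn j i)) (λ s → t i * C j s) v) ⟩
          lincomb D v ∎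
        D₀≡0 : D zero ≡ 0#
        D₀≡0 = begin
          c + (- (c * pivot⁻¹)) * γ ≡⟨ solve 3 (λ c g γ → c :+ ((:- (c :* g)) :* γ) := c :- c :* (γ :* g)) refl c pivot⁻¹ γ ⟩
          c + (- (c * (γ * pivot⁻¹))) ≡⟨ cong (λ x → c + (- (c * x))) (*-inv γ pivot≢0) ⟩
          c + (- (c * 1#))            ≡⟨ cong (λ x → c + (- x)) (*-identityʳ c) ⟩
          c + (- c)                   ≡⟨ -‿inverseʳ c ⟩
          0# ∎
          where
          c = C (punchIn j i) zero
          γ = C j zero

      reduced-independent : Independent u → Independent reduced
      reduced-independent u-indep d d-Fq lincomb≡o i =
        trans (sym (insertAt-punchIn d j α i)) (u-indep e e-Fq lincomb-e≡o (punchIn j i))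
        where
        α = lincombK d t
        e = insertAt d j α
        e-Fq : ∀ x → Fq F (e x)
        e-Fq = insertAt-preserves (Fq F) d j d-Fq (Fq-lincomb d t d-Fq t-Fq)
        lincomb-e≡o : lincomb e u ≡ o
        lincomb-e≡o = begin
          lincomb e u
            ≡⟨ lincomb-punchIn e u j ⟩
          (e j · u j) ⊕ lincomb (e ∘ punchIn j) (u ∘ punchIn j)
            ≡⟨ cong₂ _⊕_ (cong (_· u j) (insertAt-lookup d j α)) (lincomb-cong (insertAt-punchIn d j α) (λ _ → refl)) ⟩
          (α · u j) ⊕ lincomb d (u ∘ punchIn j)
            ≡⟨ ⊕-comm _ _ ⟩
          lincomb d (u ∘ punchIn j) ⊕ (α · u j)
            ≡⟨ sym (lincomb-⊕· d (u ∘ punchIn j) t (u j)) ⟩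
          lincomb d reduced
            ≡⟨ lincomb≡o ⟩
          o ∎

    steinitz : ∀ k {m} (v : Fin k → V) (u : Fin m → V) → Independent u → (∀ i → InSpan v (u i)) → m ≤ k
    steinitz zero {zero}  v u u-indep u-span = z≤n
    steinitz zero {suc m} v u u-indep u-span = ⊥-elim (independent⇒head≢o u u-indep (proj₂ (proj₂ (u-span zero))))
    steinitz (suc k) {zero} v u u-indep u-span = z≤n
    steinitz (suc k) {suc m} v u u-indep u-span with any? (λ j → ¬? (proj₁ (u-span j) zero ≟ 0#))
    ... | yes (j , pivot≢0) = s≤s (steinitz k (tail v) reduced (reduced-independent u-indep) reduced-inSpan)
      where open PivotElimination v u u-span j pivot≢0
    ... | no no-pivot = ℕ.m≤n⇒m≤1+n (steinitz k (tail v) u u-indep (λ j → InSpan-tail v (u-span j) (pivot≡0 j)))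
      where
      pivot≡0 : ∀ j → proj₁ (u-span j) zero ≡ 0#
      pivot≡0 j = decidable-stable (_ ≟ 0#) (λ pivot≢0 → no-pivot (j , pivot≢0))

    -- Opaque because the index is found by exhaustive search: unfolding it in a
    -- type would make the type checker run that search.
    opaque
      escape : ∀ {k m} (G : Fin k → V) (u : Fin m → V) → Independent u → k < m →
               (P : V → Set) → Decidable P → (∀ i → P (u i) → InSpan G (u i)) → ∃[ i ] ¬ P (u i)
      escape {k} G u u-indep k<m P P? P⇒inSpan with any? (λ i → ¬? (P? (u i)))
      ... | yes found = found
      ... | no none = ⊥-elim (ℕ.<⇒≱ k<m (steinitz k G u u-indep (λ i → P⇒inSpan i (all-P i))))
        where
        all-P : ∀ i → P (u i)
        all-P i = decidable-stable (P? (u i)) (λ ¬P → none (i , ¬P))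

    lincomb₁ : (c : Fin 1 → K) (u : Fin 1 → V) → lincomb c u ≡ c zero · u zero
    lincomb₁ c u = trans (⊕-comm _ o) (⊕-identityˡ _)

  -- Coordinates on K²

  K² : Set
  K² = V2 F

  infixl 6 _⊕_
  infixr 7 _·_

  _⊕_ : K² → K² → K²
  _⊕_ = _⊞_ F

  _·_ : K → K² → K²
  _·_ = _⊙_ F

  0v : K²
  0v = 𝟘 F

  K²-isFqSpace : IsFqSpace K² _⊕_ 0v _·_
  K²-isFqSpace = record
    { ⊕-assoc     = λ _ _ _ → cong₂ _,_ (+-assoc _ _ _) (+-assoc _ _ _)
    ; ⊕-comm      = λ _ _ → cong₂ _,_ (+-comm _ _) (+-comm _ _)
    ; ⊕-identityˡ = λ _ → cong₂ _,_ (+-identityˡ _) (+-identityˡ _)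
    ; ·-distribʳ  = λ _ _ _ → cong₂ _,_ (distribʳ _ _ _) (distribʳ _ _ _)
    ; ·-distribˡ  = λ _ _ _ → cong₂ _,_ (distribˡ _ _ _) (distribˡ _ _ _)
    ; ·-assoc     = λ _ _ _ → cong₂ _,_ (*-assoc _ _ _) (*-assoc _ _ _)
    ; ·-zeroˡ     = λ _ → cong₂ _,_ (zeroˡ _) (zeroˡ _)
    ; ·-zeroʳ     = λ _ → cong₂ _,_ (zeroʳ _) (zeroʳ _)
    ; ·-identityˡ = λ _ → cong₂ _,_ (*-identityˡ _) (*-identityˡ _)
    }

  open IsFqSpace K²-isFqSpace
  open FqSpace K²-isFqSpace

  ·-cancelʳ : ∀ {a b} w → w ≢ 0v → a · w ≡ b · w → a ≡ b
  ·-cancelʳ (w₁ , w₂) w≢0 aw≡bw with w₁ ≟ 0#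
  ... | no  w₁≢0 = *-cancelʳ w₁≢0 (cong proj₁ aw≡bw)
  ... | yes w₁≡0 = *-cancelʳ (λ w₂≡0 → w≢0 (cong₂ _,_ w₁≡0 w₂≡0)) (cong proj₂ aw≡bw)

  weight-one⇒Fq-multiple : ∀ {W : K² → Set} {z μ} → Weight F W z 1 → W z → z ≢ 0v → W (μ · z) → Fq F μ
  weight-one⇒Fq-multiple {W} {z} {μ} (f , _ , _ , f-span) z-W z≢0 μz-W =
    Fq-cancelʳ c≢0 (proj₁ (proj₂ z-span) zero) (subst (Fq F) (sym μc≡d) (proj₁ (proj₂ μz-span) zero))
    where
    z-span = f-span z (z-W , 1# , sym (·-identityˡ z))
    μz-span = f-span (μ · z) (μz-W , μ , refl)
    c = proj₁ z-span zero
    d = proj₁ μz-span zero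
    z≡ : z ≡ c · f zero
    z≡ = trans (proj₂ (proj₂ z-span)) (lincomb₁ (proj₁ z-span) f)
    c≢0 : c ≢ 0#
    c≢0 c≡0 = z≢0 (trans z≡ (trans (cong (_· f zero) c≡0) (·-zeroˡ (f zero))))
    f≢0 : f zero ≢ 0v
    f≢0 f≡0 = z≢0 (trans z≡ (trans (cong (c ·_) f≡0) (·-zeroʳ c)))
    μc≡d : μ * c ≡ d
    μc≡d = ·-cancelʳ (f zero) f≢0 (begin
      (μ * c) · f zero   ≡⟨ ·-assoc μ c (f zero) ⟩
      μ · (c · f zero)   ≡⟨ cong (μ ·_) (sym z≡) ⟩
      μ · z              ≡⟨ proj₂ (proj₂ μz-span) ⟩
      lincomb (proj₁ μz-span) f ≡⟨ lincomb₁ (proj₁ μz-span) f ⟩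
      d · f zero         ∎)

  InPoint-refl : ∀ w → InPoint F w w
  InPoint-refl w = 1# , sym (·-identityˡ w)

  det : K² → K² → K
  det (x₁ , x₂) (y₁ , y₂) = x₁ * y₂ - x₂ * y₁

  det-·· : ∀ λ′ μ w → det (λ′ · w) (μ · w) ≡ 0#
  det-·· λ′ μ (w₁ , w₂) = solve 4 (λ l m a b → l :* a :* (m :* b) :- l :* b :* (m :* a) := :0) refl λ′ μ w₁ w₂

  ∃det≢0 : ∀ e → e ≢ 0v → ∃[ f ] det e f ≢ 0#
  ∃det≢0 (e₁ , e₂) e≢0 with e₁ ≟ 0#
  ... | no e₁≢0 = (0# , 1#) , λ det≡0 →
    e₁≢0 (trans (solve 2 (λ a b → a := a :* :1 :- b :* :0) refl e₁ e₂) det≡0)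
  ... | yes e₁≡0 = (- 1# , 0#) , λ det≡0 →
    e≢0 (cong₂ _,_ e₁≡0 (trans (solve 2 (λ a b → b := a :* :0 :- b :* (:- :1)) refl e₁ e₂) det≡0))

  module _ (α β γ δ : K) where
    private M = act F α β γ δ

    act-⊕ : ∀ u w → M (u ⊕ w) ≡ M u ⊕ M w
    act-⊕ (u₁ , u₂) (w₁ , w₂) = cong₂ _,_ (lin α β) (lin γ δ)
      where
      lin : ∀ a b → a * (u₁ + w₁) + b * (u₂ + w₂) ≡ (a * u₁ + b * u₂) + (a * w₁ + b * w₂)
      lin a b = solve 6 (λ a b u₁ u₂ w₁ w₂ → a :* (u₁ :+ w₁) :+ b :* (u₂ :+ w₂) := (a :* u₁ :+ b :* u₂) :+ (a :* w₁ :+ b :* w₂)) refl a b u₁ u₂ w₁ w₂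

    act-· : ∀ c w → M (c · w) ≡ c · M w
    act-· c (w₁ , w₂) = cong₂ _,_ (hom α β) (hom γ δ)
      where
      hom : ∀ a b → a * (c * w₁) + b * (c * w₂) ≡ c * (a * w₁ + b * w₂)
      hom a b = solve 5 (λ a b c w₁ w₂ → a :* (c :* w₁) :+ b :* (c :* w₂) := c :* (a :* w₁ :+ b :* w₂)) refl a b c w₁ w₂

    act-0v : M 0v ≡ 0v
    act-0v = cong₂ _,_ (vanish α β) (vanish γ δ)
      where
      vanish : ∀ a b → a * 0# + b * 0# ≡ 0#
      vanish a b = solve 2 (λ a b → a :* :0 :+ b :* :0 := :0) refl a b

  module Frame (e f : K²) (Δ≢0 : det e f ≢ 0#) where
    private
      e₁ = proj₁ e
      e₂ = proj₂ e
      f₁ = proj₁ f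
      f₂ = proj₂ f
      Δ = det e f

    δ : K
    δ = inv Δ Δ≢0

    -- T is the inverse of the matrix with columns e and f - e, so that T e = (1 , 0)
    -- and T f = (1 , 1).
    t₁₁ t₁₂ t₂₁ t₂₂ : K
    t₁₁ = δ * (f₂ - e₂)
    t₁₂ = δ * (e₁ - f₁)
    t₂₁ = - (δ * e₂)
    t₂₂ = δ * e₁

    T : K² → K²
    T = act F t₁₁ t₁₂ t₂₁ t₂₂

    X Y : K² → K
    X w = proj₁ (T w)
    Y w = proj₂ (T w)

    T-⊕ : ∀ u w → T (u ⊕ w) ≡ T u ⊕ T w
    T-⊕ = act-⊕ _ _ _ _

    T-· : ∀ c w → T (c · w) ≡ c · T w
    T-· = act-· _ _ _ _

    T-0v : T 0v ≡ 0v
    T-0v = act-0v _ _ _ _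

    private
      ·Δδ : ∀ x → x * (Δ * δ) ≡ x
      ·Δδ x = trans (cong (x *_) (*-inv Δ Δ≢0)) (*-identityʳ x)

    T-e : T e ≡ (1# , 0#)
    T-e = cong₂ _,_
      (trans (solve 5 (λ a b c d δ → δ :* (d :- b) :* a :+ δ :* (a :- c) :* b := :1 :* ((a :* d :- b :* c) :* δ)) refl e₁ e₂ f₁ f₂ δ) (·Δδ 1#))
      (solve 3 (λ a b δ → :- (δ :* b) :* a :+ δ :* a :* b := :0) refl e₁ e₂ δ)

    T-f : T f ≡ (1# , 1#)
    T-f = cong₂ _,_
      (trans (solve 5 (λ a b c d δ → δ :* (d :- b) :* c :+ δ :* (a :- c) :* d := :1 :* ((a :* d :- b :* c) :* δ)) refl e₁ e₂ f₁ f₂ δ) (·Δδ 1#))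
      (trans (solve 5 (λ a b c d δ → :- (δ :* b) :* c :+ δ :* a :* d := :1 :* ((a :* d :- b :* c) :* δ)) refl e₁ e₂ f₁ f₂ δ) (·Δδ 1#))

    Y≡δ*det : ∀ w → Y w ≡ δ * det e w
    Y≡δ*det (w₁ , w₂) = solve 5 (λ a b δ x y → :- (δ :* b) :* x :+ δ :* a :* y := δ :* (a :* y :- b :* x)) refl e₁ e₂ δ w₁ w₂

    T-det : t₁₁ * t₂₂ - t₁₂ * t₂₁ ≡ δ
    T-det = trans (solve 5 (λ a b c d δ → δ :* (d :- b) :* (δ :* a) :- δ :* (a :- c) :* (:- (δ :* b)) := δ :* ((a :* d :- b :* c) :* δ)) refl e₁ e₂ f₁ f₂ δ) (·Δδ δ)

    δ≢0 : δ ≢ 0#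
    δ≢0 δ≡0 = 0≢1 (begin
      0#     ≡⟨ sym (zeroʳ Δ) ⟩
      Δ * 0# ≡⟨ cong (Δ *_) (sym δ≡0) ⟩
      Δ * δ  ≡⟨ *-inv Δ Δ≢0 ⟩
      1#     ∎)

    T-inverse : ∀ w → (X w - Y w) · e ⊕ Y w · f ≡ w
    T-inverse (w₁ , w₂) = cong₂ _,_
      (trans (solve 7 (λ x y a b c d δ → (δ :* (d :- b) :* x :+ δ :* (a :- c) :* y :- (:- (δ :* b) :* x :+ δ :* a :* y)) :* a :+ (:- (δ :* b) :* x :+ δ :* a :* y) :* c
          := x :* ((a :* d :- b :* c) :* δ)) refl w₁ w₂ e₁ e₂ f₁ f₂ δ) (·Δδ w₁))
      (trans (solve 7 (λ x y a b c d δ → (δ :* (d :- b) :* x :+ δ :* (a :- c) :* y :- (:- (δ :* b) :* x :+ δ :* a :* y)) :* b :+ (:- (δ :* b) :* x :+ δ :* a :* y) :* d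
          := y :* ((a :* d :- b :* c) :* δ)) refl w₁ w₂ e₁ e₂ f₁ f₂ δ) (·Δδ w₂))

    T-injective : ∀ {u w} → T u ≡ T w → u ≡ w
    T-injective {u} {w} Tu≡Tw = begin
      u                             ≡⟨ sym (T-inverse u) ⟩
      (X u - Y u) · e ⊕ Y u · f     ≡⟨ cong (λ v → (proj₁ v - proj₂ v) · e ⊕ proj₂ v · f) Tu≡Tw ⟩
      (X w - Y w) · e ⊕ Y w · f     ≡⟨ T-inverse w ⟩
      w                             ∎

    Y≡0⇒multiple : ∀ {w} → Y w ≡ 0# → w ≡ X w · e
    Y≡0⇒multiple {w} Yw≡0 = begin
      w                             ≡⟨ sym (T-inverse w) ⟩
      (X w - Y w) · e ⊕ Y w · f     ≡⟨ cong (λ y → (X w - y) · e ⊕ y · f) Yw≡0 ⟩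
      (X w - 0#) · e ⊕ 0# · f       ≡⟨ cong₂ _⊕_ (cong (_· e) (solve 1 (λ x → x :- :0 := x) refl (X w))) (·-zeroˡ f) ⟩
      X w · e ⊕ 0v                  ≡⟨ trans (⊕-comm _ 0v) (⊕-identityˡ _) ⟩
      X w · e                       ∎

  det≡0⇒multiple : ∀ {e w} → e ≢ 0v → det e w ≡ 0# → ∃[ κ ] w ≡ κ · e
  det≡0⇒multiple {e} {w} e≢0 det≡0 = X w , Y≡0⇒multiple (trans (Y≡δ*det w) (trans (cong (δ *_) det≡0) (zeroʳ δ)))
    where open Frame e (proj₁ (∃det≢0 e e≢0)) (proj₂ (∃det≢0 e e≢0))

  -- Normal form of an h-club of rank h + 2

  module ClubNormalForm {h : ℕ} (W : K² → Set) (W-subspace : IsSubspace2 F W)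
      (B : Fin (suc h ℕ.+ 2) → K²) (B-W : ∀ i → W (B i)) (B-indep : Independent B)
      (B-span : ∀ w → W w → InSpan B w)
      (v : K²) (E : Fin (suc h) → K²) (E-W-v : ∀ i → W (E i) × InPoint F v (E i))
      (E-indep : Independent E) (E-span : ∀ w → W w × InPoint F v w → InSpan E w)
      (weight-one : ∀ w → w ≢ 0v → InLinSet F W w → ¬ InPoint F v w → Weight F W w 1)
      where

    W-0v : W 0v
    W-0v = proj₁ W-subspace

    W-⊕ : ∀ {u w} → W u → W w → W (u ⊕ w)
    W-⊕ = proj₁ (proj₂ W-subspace) _ _

    W-· : ∀ {c w} → Fq F c → W w → W (c · w)
    W-· = proj₂ (proj₂ W-subspace) _ _

    e₁ : K²
    e₁ = E zero

    e₁≢0 : e₁ ≢ 0v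
    e₁≢0 = independent⇒head≢o E E-indep

    λ₁ : K
    λ₁ = proj₁ (proj₂ (E-W-v zero))

    e₁≡ : e₁ ≡ λ₁ · v
    e₁≡ = proj₂ (proj₂ (E-W-v zero))

    ·e₁-onPoint : ∀ κ → InPoint F v (κ · e₁)
    ·e₁-onPoint κ = κ * λ₁ , trans (cong (κ ·_) e₁≡) (sym (·-assoc κ λ₁ v))

    onPoint⇒det≡0 : ∀ {w} → InPoint F v w → det e₁ w ≡ 0#
    onPoint⇒det≡0 (μ , w≡) = trans (cong₂ det e₁≡ w≡) (det-·· λ₁ μ v)

    det≡0⇒onPoint : ∀ {w} → det e₁ w ≡ 0# → InPoint F v w
    det≡0⇒onPoint det≡0 = subst (InPoint F v) (sym (proj₂ multiple)) (·e₁-onPoint (proj₁ multiple))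
      where multiple = det≡0⇒multiple e₁≢0 det≡0

    dim≡ : suc h ℕ.+ 2 ≡ suc (suc (suc h))
    dim≡ = ℕ.+-comm (suc h) 2

    w₂-index : ∃[ i ] det e₁ (B i) ≢ 0#
    w₂-index = escape E B B-indep (ℕ.m<m+n (suc h) (s≤s z≤n)) (λ w → det e₁ w ≡ 0#) (λ w → det e₁ w ≟ 0#)
      (λ i det≡0 → E-span (B i) (B-W i , det≡0⇒onPoint det≡0))

    w₂ : K²
    w₂ = B (proj₁ w₂-index)

    open Frame e₁ w₂ (proj₂ w₂-index)

    onPoint⇒Y≡0 : ∀ {w} → InPoint F v w → Y w ≡ 0#
    onPoint⇒Y≡0 {w} onPoint = trans (Y≡δ*det w) (trans (cong (δ *_) (onPoint⇒det≡0 onPoint)) (zeroʳ δ))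

    w₃-index : ∃[ j ] ¬ Fq F (Y (B j))
    w₃-index = escape (w₂ ∷ E) B B-indep (subst (suc (suc h) <_) (sym dim≡) (ℕ.n<1+n _)) (Fq F ∘ Y) (Fq? ∘ Y) B-inSpan
      where
      B-inSpan : ∀ j → Fq F (Y (B j)) → InSpan (w₂ ∷ E) (B j)
      B-inSpan j y-Fq = subst (InSpan (w₂ ∷ E)) (·-neg-cancelˡ y w₂ (B j)) (InSpan-∷ w₂ E y-Fq (E-span z (z-W , z-onPoint)))
        where
        y = Y (B j)
        z = (- y) · w₂ ⊕ B j
        z-W : W z
        z-W = W-⊕ (W-· (Fq-neg _ y-Fq) (B-W _)) (B-W j)
        z-onPoint : InPoint F v z
        z-onPoint = subst (InPoint F v) (sym (Y≡0⇒multiple Yz≡0)) (·e₁-onPoint (X z))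
          where
          Yz≡0 : Y z ≡ 0#
          Yz≡0 = begin
            Y z                    ≡⟨ cong proj₂ (trans (T-⊕ _ _) (cong (_⊕ T (B j)) (T-· (- y) w₂))) ⟩
            - y * Y w₂ + y         ≡⟨ cong (λ c → - y * c + y) (cong proj₂ T-f) ⟩
            - y * 1# + y           ≡⟨ solve 1 (λ y → :- y :* :1 :+ y := :0) refl y ⟩
            0#                     ∎

    w₃ : K²
    w₃ = B (proj₁ w₃-index)

    a b : K
    a = X w₃
    b = Y w₃

    b∉Fq : ¬ Fq F b
    b∉Fq = proj₂ w₃-index

    σ : Fin (suc h) → K
    σ i = X (E i)

    E≡ : ∀ i → E i ≡ σ i · e₁
    E≡ i = Y≡0⇒multiple (onPoint⇒Y≡0 (proj₂ (E-W-v i)))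

    E-lincomb : ∀ c → lincomb c E ≡ lincombK c σ · e₁
    E-lincomb c = trans (lincomb-cong {c = c} (λ _ → refl) E≡) (lincomb-scaled c σ e₁)

    w₂-W : W w₂
    w₂-W = B-W _

    w₃-W : W w₃
    w₃-W = B-W _

    X-·e₁ : ∀ κ → X (κ · e₁) ≡ κ
    X-·e₁ κ = trans (cong proj₁ (trans (T-· κ e₁) (cong (κ ·_) T-e))) (*-identityʳ κ)

    Y-·e₁ : ∀ κ → Y (κ · e₁) ≡ 0#
    Y-·e₁ κ = trans (cong proj₂ (trans (T-· κ e₁) (cong (κ ·_) T-e))) (zeroʳ κ)

    T-w₂w₃⊕ : ∀ x y u → T (x · w₂ ⊕ (y · w₃ ⊕ u)) ≡ (x + y * a + X u , x + y * b + Y u)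
    T-w₂w₃⊕ x y u = begin
      T (x · w₂ ⊕ (y · w₃ ⊕ u))            ≡⟨ T-⊕ _ _ ⟩
      T (x · w₂) ⊕ T (y · w₃ ⊕ u)          ≡⟨ cong (T (x · w₂) ⊕_) (T-⊕ _ _) ⟩
      T (x · w₂) ⊕ (T (y · w₃) ⊕ T u)      ≡⟨ cong₂ (λ p r → p ⊕ (r ⊕ T u)) (T-· x w₂) (T-· y w₃) ⟩
      x · T w₂ ⊕ (y · T w₃ ⊕ T u)          ≡⟨ cong (λ p → x · p ⊕ (y · T w₃ ⊕ T u)) T-f ⟩
      x · (1# , 1#) ⊕ (y · (a , b) ⊕ T u)
        ≡⟨ cong₂ _,_ (solve 4 (λ x y a r → x :* :1 :+ (y :* a :+ r) := x :+ y :* a :+ r) refl x y a (X u))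
                     (solve 4 (λ x y b r → x :* :1 :+ (y :* b :+ r) := x :+ y :* b :+ r) refl x y b (Y u)) ⟩
      (x + y * a + X u , x + y * b + Y u) ∎

    combination : K → K → K → K²
    combination x y s = x · w₂ ⊕ (y · w₃ ⊕ s · e₁)

    T-combination : ∀ x y s → T (combination x y s) ≡ (x + y * a + s , x + y * b)
    T-combination x y s = trans (T-w₂w₃⊕ x y (s · e₁))
      (cong₂ _,_ (cong (x + y * a +_) (X-·e₁ s)) (trans (cong (x + y * b +_) (Y-·e₁ s)) (+-identityʳ _)))

    S : K → Set
    S σ = W (σ · e₁)

    combination-W : ∀ {x y s} → Fq F x → Fq F y → S s → W (combination x y s)
    combination-W x-Fq y-Fq s-S = W-⊕ (W-· x-Fq w₂-W) (W-⊕ (W-· y-Fq w₃-W) s-S)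

    Y∉Fq⟨1,b⟩⇒independent : ∀ w → ¬ InFq⟨1, b ⟩ (Y w) → Independent (w₂ ∷ w₃ ∷ w ∷ E)
    Y∉Fq⟨1,b⟩⇒independent w Yw∉ c c-Fq lincomb≡0 = c≡0
      where
      c₀ = c zero
      c₁ = c (suc zero)
      c₂ = c (suc (suc zero))
      c′ = tail (tail (tail c))
      L = lincomb c′ E
      Y-c₂w⊕L : Y (c₂ · w ⊕ L) ≡ c₂ * Y w
      Y-c₂w⊕L = begin
        Y (c₂ · w ⊕ L)  ≡⟨ cong proj₂ (trans (T-⊕ _ L) (cong (_⊕ T L) (T-· c₂ w))) ⟩
        c₂ * Y w + Y L  ≡⟨ cong (c₂ * Y w +_) (trans (cong Y (E-lincomb c′)) (Y-·e₁ _)) ⟩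
        c₂ * Y w + 0#   ≡⟨ +-identityʳ _ ⟩
        c₂ * Y w        ∎
      Ysum : c₀ + c₁ * b + c₂ * Y w ≡ 0#
      Ysum = begin
        c₀ + c₁ * b + c₂ * Y w               ≡⟨ cong (c₀ + c₁ * b +_) (sym Y-c₂w⊕L) ⟩
        c₀ + c₁ * b + Y (c₂ · w ⊕ L)         ≡⟨ sym (cong proj₂ (T-w₂w₃⊕ c₀ c₁ (c₂ · w ⊕ L))) ⟩
        Y (lincomb c (w₂ ∷ w₃ ∷ w ∷ E))      ≡⟨ cong Y lincomb≡0 ⟩
        Y 0v                                 ≡⟨ cong proj₂ T-0v ⟩
        0#                                   ∎
      c₀₁₂≡0 = Fq-independent₃ b∉Fq Yw∉ (c-Fq zero) (c-Fq (suc zero)) (c-Fq (suc (suc zero))) Ysum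
      L≡0 : L ≡ 0v
      L≡0 = begin
        L                                    ≡⟨ sym (·-zero-⊕ w L (proj₂ (proj₂ c₀₁₂≡0))) ⟩
        c₂ · w ⊕ L                           ≡⟨ sym (·-zero-⊕ w₃ _ (proj₁ (proj₂ c₀₁₂≡0))) ⟩
        c₁ · w₃ ⊕ (c₂ · w ⊕ L)               ≡⟨ sym (·-zero-⊕ w₂ _ (proj₁ c₀₁₂≡0)) ⟩
        lincomb c (w₂ ∷ w₃ ∷ w ∷ E)          ≡⟨ lincomb≡0 ⟩
        0v                                   ∎
      c≡0 : ∀ i → c i ≡ 0#
      c≡0 zero                = proj₁ c₀₁₂≡0
      c≡0 (suc zero)          = proj₁ (proj₂ c₀₁₂≡0)
      c≡0 (suc (suc zero))    = proj₂ (proj₂ c₀₁₂≡0)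
      c≡0 (suc (suc (suc i))) = E-indep c′ (λ j → c-Fq (suc (suc (suc j)))) L≡0 i

    Y-in-Fq⟨1,b⟩ : ∀ {w} → W w → InFq⟨1, b ⟩ (Y w)
    Y-in-Fq⟨1,b⟩ {w} w-W = decidable-stable (InFq⟨1,?⟩ b (Y w)) λ Yw∉ →
      ℕ.<⇒≱ (subst (_< suc (suc (suc (suc h)))) (sym dim≡) (ℕ.n<1+n _))
            (steinitz _ B G (Y∉Fq⟨1,b⟩⇒independent w Yw∉) (λ i → B-span (G i) (G-W i)))
      where
      G = w₂ ∷ w₃ ∷ w ∷ E
      G-W : ∀ i → W (G i)
      G-W zero                = w₂-W
      G-W (suc zero)          = w₃-W
      G-W (suc (suc zero))    = w-W
      G-W (suc (suc (suc i))) = proj₁ (E-W-v i)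

    S-subspace : IsSubspace1 F S
    S-subspace = subst W (sym (·-zeroˡ e₁)) W-0v
               , (λ σ τ σ-S τ-S → subst W (sym (·-distribʳ σ τ e₁)) (W-⊕ σ-S τ-S))
               , (λ l σ l-Fq σ-S → subst W (sym (·-assoc l σ e₁)) (W-· l-Fq σ-S))

    1∈S : S 1#
    1∈S = subst W (sym (·-identityˡ e₁)) (proj₁ (E-W-v zero))

    S-dim : HasDim1 F S (suc h)
    S-dim = σ , σ-S , σ-independent , σ-span
      where
      σ-S : ∀ i → S (σ i)
      σ-S i = subst W (E≡ i) (proj₁ (E-W-v i))
      σ-independent : ∀ c → (∀ i → Fq F (c i)) → lincombK c σ ≡ 0# → ∀ i → c i ≡ 0#
      σ-independent c c-Fq lincomb≡0 =
        E-indep c c-Fq (trans (E-lincomb c) (trans (cong (_· e₁) lincomb≡0) (·-zeroˡ e₁)))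
      σ-span : ∀ s → S s → Σ (Fin (suc h) → K) λ c → (∀ i → Fq F (c i)) × s ≡ lincombK c σ
      σ-span s s-S =
        let c , c-Fq , se₁≡ = E-span (s · e₁) (s-S , ·e₁-onPoint s)
        in  c , c-Fq , ·-cancelʳ e₁ e₁≢0 (trans se₁≡ (E-lincomb c))

    T-W⊆ClubU : ∀ {w} → W w → InFq⟨1, b ⟩ (Y w) → ClubU F S a b (T w)
    T-W⊆ClubU {w} w-W (x , y , x-Fq , y-Fq , Yw≡) = X z , x , y , z-S , x-Fq , y-Fq , cong₂ _,_ Xw≡ Yw≡
      where
      z = (- x) · w₂ ⊕ ((- y) · w₃ ⊕ w)
      Tz≡ : T z ≡ (- x + - y * a + X w , - x + - y * b + Y w)
      Tz≡ = T-w₂w₃⊕ (- x) (- y) w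
      Yz≡0 : Y z ≡ 0#
      Yz≡0 = begin
        Y z                            ≡⟨ cong proj₂ Tz≡ ⟩
        - x + - y * b + Y w            ≡⟨ cong (- x + - y * b +_) Yw≡ ⟩
        - x + - y * b + (x + y * b)    ≡⟨ solve 3 (λ x y b → :- x :+ :- y :* b :+ (x :+ y :* b) := :0) refl x y b ⟩
        0#                             ∎
      z-S : S (X z)
      z-S = subst W (Y≡0⇒multiple Yz≡0) (W-⊕ (W-· (Fq-neg _ x-Fq) w₂-W) (W-⊕ (W-· (Fq-neg _ y-Fq) w₃-W) w-W))
      Xw≡ : X w ≡ X z + x + y * a
      Xw≡ = begin
        X w                                   ≡⟨ solve 4 (λ x y a r → r := :- x :+ :- y :* a :+ r :+ x :+ y :* a) refl x y a (X w) ⟩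
        - x + - y * a + X w + x + y * a       ≡⟨ cong (λ r → r + x + y * a) (sym (cong proj₁ Tz≡)) ⟩
        X z + x + y * a                       ∎

    ClubU⊆T-W : ∀ {u} → ClubU F S a b u → ∃[ w ] W w × T w ≡ u
    ClubU⊆T-W (s , x , y , s-S , x-Fq , y-Fq , u≡) =
      combination x y s , combination-W x-Fq y-Fq s-S ,
      trans (T-combination x y s)
            (trans (cong₂ _,_ (solve 4 (λ x y a s → x :+ y :* a :+ s := s :+ x :+ y :* a) refl x y a s) refl) (sym u≡))

    a∉S+bS : ¬ InSumBS F S b a
    a∉S+bS (s , t , s-S , t-S , a≡) =
      b∉Fq (weight-one⇒Fq-multiple (weight-one z₁ z₁≢0 (z₁ , z₁-W , z₁≢0 , InPoint-refl z₁) z₁∉point)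
                                   z₁-W z₁≢0 (subst W z₂≡bz₁ z₂-W))
      where
      S-+ = proj₁ (proj₂ S-subspace)
      S-* = proj₂ (proj₂ S-subspace)
      -1-Fq = Fq-neg _ Fq-1
      z₁ = combination 1# 0# (t - 1#)
      z₂ = combination 0# 1# (- s)
      z₁-W : W z₁
      z₁-W = combination-W Fq-1 Fq-0 (S-+ t _ t-S (subst S (*-identityʳ (- 1#)) (S-* _ 1# -1-Fq 1∈S)))
      z₂-W : W z₂
      z₂-W = combination-W Fq-0 Fq-1 (subst S (-1*x≈-x s) (S-* _ s -1-Fq s-S))
      Tz₁≡ : T z₁ ≡ (t , 1#)
      Tz₁≡ = trans (T-combination 1# 0# (t - 1#))
        (cong₂ _,_ (solve 2 (λ a t → :1 :+ :0 :* a :+ (t :- :1) := t) refl a t)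
                   (solve 1 (λ b → :1 :+ :0 :* b := :1) refl b))
      z₂≡bz₁ : z₂ ≡ b · z₁
      z₂≡bz₁ = T-injective (begin
        T z₂                                ≡⟨ T-combination 0# 1# (- s) ⟩
        (0# + 1# * a + - s , 0# + 1# * b)   ≡⟨ cong (λ a → (0# + 1# * a + - s , 0# + 1# * b)) a≡ ⟩
        (0# + 1# * (s + b * t) + - s , 0# + 1# * b)
          ≡⟨ cong₂ _,_ (solve 3 (λ s b t → :0 :+ :1 :* (s :+ b :* t) :+ :- s := b :* t) refl s b t)
                       (solve 1 (λ b → :0 :+ :1 :* b := b :* :1) refl b) ⟩
        b · (t , 1#)                        ≡⟨ cong (b ·_) (sym Tz₁≡) ⟩
        b · T z₁                            ≡⟨ sym (T-· b z₁) ⟩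
        T (b · z₁)                          ∎)
      Yz₁≢0 : Y z₁ ≢ 0#
      Yz₁≢0 Yz₁≡0 = 0≢1 (trans (sym Yz₁≡0) (cong proj₂ Tz₁≡))
      z₁≢0 : z₁ ≢ 0v
      z₁≢0 z₁≡0 = Yz₁≢0 (trans (cong Y z₁≡0) (cong proj₂ T-0v))
      z₁∉point : ¬ InPoint F v z₁
      z₁∉point = Yz₁≢0 ∘ onPoint⇒Y≡0

    a∉S : ¬ S a
    a∉S a-S = a∉S+bS (a , 0# , a-S , proj₁ S-subspace , sym (trans (cong (a +_) (zeroʳ b)) (+-identityʳ a)))

    T-equivalence : PGLEquiv F W (ClubU F S a b)
    T-equivalence = t₁₁ , t₁₂ , t₂₁ , t₂₂ , (λ det≡0 → δ≢0 (trans (sym T-det) det≡0)) , T-W⇒ClubU , ClubU⇒T-W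
      where
      T-W⇒ClubU : ∀ w → W w → w ≢ 0v → InLinSet F (ClubU F S a b) (T w)
      T-W⇒ClubU w w-W w≢0 =
        T w , T-W⊆ClubU w-W (Y-in-Fq⟨1,b⟩ w-W) , (λ Tw≡0 → w≢0 (T-injective (trans Tw≡0 (sym T-0v)))) , InPoint-refl (T w)
      ClubU⇒T-W : ∀ u → ClubU F S a b u → u ≢ 0v → ∃[ w ] W w × w ≢ 0v × InPoint F (T w) u
      ClubU⇒T-W u u-ClubU u≢0 =
        let w , w-W , Tw≡u = ClubU⊆T-W u-ClubU
        in  w , w-W , (λ w≡0 → u≢0 (trans (sym Tw≡u) (trans (cong T w≡0) T-0v)))
          , subst (InPoint F (T w)) Tw≡u (InPoint-refl (T w))

open import Data.Nat using (ℕ; _+_; _≤_; _<_)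
open import Data.Product using (∃-syntax; _×_)
open import Relation.Nullary using (¬_)
open FFExt using (K; 1#)

lemma3p4 : (q n : ℕ) → IsPrimePower q → (F : FFExt q n)
    → (h : ℕ) → 0 < h → h + 2 ≤ n
    → (W : V2 F → Set) → IsClub F h (h + 2) W
    → ∃[ S ] ∃[ a ] ∃[ b ]
        (IsSubspace1 F S × HasDim1 F S h × S (1# F)
        × ¬ S a × ¬ Fq F b × ¬ InSumBS F S b a
        × PGLEquiv F W (ClubU F S a b))
lemma3p4 q n _ F (suc h) (s≤s z≤n) _ W
  (W-subspace , (B , B-W , B-indep , B-span) , v , _ , (E , E-W-v , E-indep , E-span) , weight-one) =
  S , a , b , S-subspace , S-dim , 1∈S , a∉S , b∉Fq , a∉S+bS , T-equivalence
  where open ClubNormalForm F W W-subspace B B-W B-indep B-span v E E-W-v E-indep E-span weight-one
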